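{- Let $k\ge 2$ be an integer and let $\mathcal{F}\subseteq\binom{[n]}{k}$ be an intersecting family with $$n\ \ge\ 2k+\left\lceil\frac{\sqrt{8k+1}-1}{2}\right\rceil+3.$$ Then $\delta_{k-1}(\mathcal{F})\le 1$. Furthermore, $\delta_{k-1}(\mathcal{F})=1$ if and only if $\mathcal{F}$ is a complete star.
   Context: $[n]=\{1,\dots,n\}$ and $\binom{[n]}{k}$ is the family of all $k$-element subsets of $[n]$. A family $\mathcal{F}$ is intersecting if $A\cap B\neq\emptyset$ for all $A,B\in\mathcal{F}$. For $S\subseteq[n]$, the $S$-degree is $d_{\mathcal{F}}(S)=|\{T\in\mathcal{F}: S\subseteq T\}|$, and for $1\le d\le k$ the minimum $d$-degree $\delta_d(\mathcal{F})$ is the minimum of $d_{\mathcal{F}}(S)$ over all $d$-element subsets $S\subseteq[n]$. A complete star (centered at $v\in[n]$) is the family of all $k$-subsets of $[n]$ containing $v$. -}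

module Defs where

open import Data.Bool using () renaming (_≟_ to _≟ᵇ_)
open import Data.Bool using (Bool; true; false; _∧_)
open import Data.Nat using (_≟_; ℕ; zero; suc; _+_; _*_; _∸_; _≤_; _⊓_)
open import Data.List using (List; []; _∷_; _++_; map; filter; length)
open import Data.Vec using (_∷_; [])
open import Data.Fin.Subset using (Subset; inside; outside; _⊆_; _∈_; _∩_; ∣_∣; Nonempty)
open import Data.Fin.Subset.Properties using (_⊆?_)
open import Relation.Nullary.Decidable using (⌊_⌋)
open import Relation.Binary.PropositionalEquality using (_≡_)
open import Data.Product using (Σ; _×_)
open import Function.Bundles using (_⇔_)

Family : ℕ → Set
Family n = Subset n → Bool

_∈F_ : {n : ℕ} → Subset n → Family n → Set
A ∈F F = F A ≡ true

IsUniform : {n : ℕ} → ℕ → Family n → Set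
IsUniform k F = ∀ A → A ∈F F → ∣ A ∣ ≡ k

IsIntersecting : {n : ℕ} → Family n → Set
IsIntersecting F = ∀ A B → A ∈F F → B ∈F F → Nonempty (A ∩ B)

allSubsets : (n : ℕ) → List (Subset n)
allSubsets zero = [] ∷ []
allSubsets (suc n) = map (outside ∷_) (allSubsets n) ++ map (inside ∷_) (allSubsets n)

subsetsOfSize : (n d : ℕ) → List (Subset n)
subsetsOfSize n d = filter (λ S → ∣ S ∣ ≟ d) (allSubsets n)

degree : {n : ℕ} → Family n → Subset n → ℕ
degree F S = length (filter (λ T → F T ∧ ⌊ S ⊆? T ⌋ ≟ᵇ true) (allSubsets _))

-- minimum of a list (the value on [] is irrelevant: only used on nonempty lists)
minList : List ℕ → ℕ
minList [] = 0
minList (x ∷ []) = x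
minList (x ∷ y ∷ ys) = x ⊓ minList (y ∷ ys)

minDegree : {n : ℕ} → ℕ → Family n → ℕ
minDegree {n} d F = minList (map (degree F) (subsetsOfSize n d))

IsCompleteStar : {n : ℕ} → ℕ → Family n → Set
IsCompleteStar {n} k F = Σ _ λ v → ∀ A → (A ∈F F) ⇔ ((∣ A ∣ ≡ k) × (v ∈ A))

-- t = ⌈(√(8k+1) − 1)/2⌉, characterised as the least natural t with 2k ≤ t(t+1)
-- (since (√(8k+1)−1)/2 ≤ t  ⇔  8k+1 ≤ (2t+1)²  ⇔  2k ≤ t(t+1)).
IsCeilTerm : ℕ → ℕ → Set
IsCeilTerm k t = (2 * k ≤ t * (t + 1)) × (∀ s → 2 * k ≤ s * (s + 1) → t ≤ s)

{-# OPTIONS --safe #-}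
-- Write k = K + 1 and suppose every K-set lies in a member of F, i.e. δ_{k-1}(F) ≥ 1. If a K-set T
-- misses a member G, the point completing T to a member lies in G. Hence the points of a member A
-- cannot all be avoided by members inside a window W ⊇ A with |W| + K ≤ n: a K-set outside W is
-- completed by a point of A, which every member inside W must contain.
-- Now let A, G ∈ F meet only in g and let y ∉ A ∪ G. Then (A − d) ∪ {y} ∈ F for every d ∈ A − g:
-- otherwise, trading subsets D ⊆ A for growing sets Y of new points yields members inside A ∪ Y
-- avoiding more and more points of A, and the budget 2u + |Y|(|Y| + 1) ≤ 2k + 2 (u the number of
-- points of A not yet avoided), together with 2k ≤ t(t + 1), keeps every window within k + t + 1
-- points until all of A is avoided. Iterated exchanges give a point x with S ∪ {x} ∈ F for every
-- K-set S ∌ x; intersecting then puts x in every member, so F is the complete star at x. In a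
-- complete star, a K-set missing the centre lies in exactly one member.
module Submission where

open import Defs
open import Data.Nat using (ℕ; _+_; _*_; _∸_; _≤_)
open import Data.Product using (Σ; _×_)
open import Relation.Binary.PropositionalEquality using (_≡_)
open import Function.Bundles using (_⇔_)

open import Data.Bool using (Bool; true; false; _∧_) renaming (_≟_ to _≟ᵇ_)
open import Data.Empty using (⊥; ⊥-elim)
open import Data.Fin using (Fin; zero; suc) renaming (_≟_ to _≟ᶠ_)
open import Data.Fin.Subset renaming (⊥ to ∅)
open import Data.Fin.Subset.Properties
open import Data.List using (List; []; _∷_; map; filter; length)
open import Data.List.Membership.Propositional using () renaming (_∈_ to _∈ˡ_)
open import Data.List.Membership.Propositional.Properties
open import Data.List.Relation.Unary.Any using (here; there)
open import Data.List.Relation.Unary.All using ([]; _∷_)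
open import Data.List.Relation.Unary.AllPairs using ([]; _∷_)
open import Data.List.Relation.Unary.Unique.Propositional using (Unique)
import Data.List.Relation.Unary.Unique.Propositional.Properties as Unique
open import Data.Nat using (zero; suc; _<_; _⊓_; z≤n; s≤s; _≤?_; _≟_)
open import Data.Nat.Induction using (<-wellFounded)
open import Data.Nat.Properties
open import Data.Nat.Tactic.RingSolver using (solve-∀)
open import Data.Product using (∃; ∃-syntax; _,_; proj₁; proj₂)
open import Data.Sum using (_⊎_; inj₁; inj₂; [_,_]′)
open import Data.Vec using (_∷_; []; here; there)
open import Function using (_∘_)
open import Function.Bundles using (mk⇔; Equivalence)
open import Induction.WellFounded using (Acc; acc)
open import Relation.Nullary using (¬_; Dec; yes; no; contradiction)
open import Relation.Nullary.Decidable using (⌊_⌋)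
open import Relation.Binary.PropositionalEquality
  using (refl; sym; trans; cong; subst; _≢_; module ≡-Reasoning)

-- Finite subsets

Disjoint : {n : ℕ} → Subset n → Subset n → Set
Disjoint p q = ∀ {x} → x ∈ p → x ∉ q

private variable
  n : ℕ
  p q r : Subset n
  x y : Fin n

x∈p─q⁻ : x ∈ p ─ q → x ∈ p × x ∉ q
x∈p─q⁻ {x = zero} {p = inside ∷ p} {q = outside ∷ q} here = here , λ ()
x∈p─q⁻ {x = suc x} {p = s ∷ p} {q = t ∷ q} (there x∈) =
  let x∈p , x∉q = x∈p─q⁻ x∈ in there x∈p , λ x∈q → x∉q (drop-there x∈q)

x∈p-y⁻ : x ∈ p - y → x ∈ p × x ≢ y
x∈p-y⁻ {y = y} x∈ =
  let x∈p , x∉⁅y⁆ = x∈p─q⁻ x∈ in x∈p , λ { refl → x∉⁅y⁆ (x∈⁅x⁆ y) }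

x∈p∪⁅y⁆⁻ : x ∈ p ∪ ⁅ y ⁆ → x ∈ p ⊎ x ≡ y
x∈p∪⁅y⁆⁻ {p = p} {y = y} x∈ with x∈p∪q⁻ p ⁅ y ⁆ x∈
... | inj₁ x∈p = inj₁ x∈p
... | inj₂ x∈⁅y⁆ = inj₂ (x∈⁅y⁆⇒x≡y y x∈⁅y⁆)

y∈p∪⁅y⁆ : y ∈ p ∪ ⁅ y ⁆
y∈p∪⁅y⁆ {y = y} = x∈p∪q⁺ (inj₂ (x∈⁅x⁆ y))

x∈p⇒⁅x⁆⊆p : x ∈ p → ⁅ x ⁆ ⊆ p
x∈p⇒⁅x⁆⊆p {x = x} {p = p} x∈p w∈⁅x⁆ = subst (_∈ p) (sym (x∈⁅y⁆⇒x≡y x w∈⁅x⁆)) x∈p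

∪-lub : p ⊆ r → q ⊆ r → p ∪ q ⊆ r
∪-lub {p = p} {q = q} p⊆r q⊆r x∈p∪q with x∈p∪q⁻ p q x∈p∪q
... | inj₁ x∈p = p⊆r x∈p
... | inj₂ x∈q = q⊆r x∈q

∪-monoˡ-⊆ : p ⊆ q → p ∪ r ⊆ q ∪ r
∪-monoˡ-⊆ p⊆q = ∪-lub (λ x∈p → x∈p∪q⁺ (inj₁ (p⊆q x∈p))) (λ x∈r → x∈p∪q⁺ (inj₂ x∈r))

∪-monoʳ-⊆ : q ⊆ r → p ∪ q ⊆ p ∪ r
∪-monoʳ-⊆ q⊆r = ∪-lub (λ x∈p → x∈p∪q⁺ (inj₁ x∈p)) (λ x∈q → x∈p∪q⁺ (inj₂ (q⊆r x∈q)))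

x∉p⇒Disjoint⁅x⁆p : x ∉ p → Disjoint ⁅ x ⁆ p
x∉p⇒Disjoint⁅x⁆p {x = x} {p = p} x∉p w∈⁅x⁆ = subst (_∉ p) (sym (x∈⁅y⁆⇒x≡y x w∈⁅x⁆)) x∉p

Disjoint-∪ : Disjoint p r → Disjoint q r → Disjoint (p ∪ q) r
Disjoint-∪ {p = p} {q = q} p#r q#r x∈p∪q = [ p#r , q#r ]′ (x∈p∪q⁻ p q x∈p∪q)

p-x∪⁅x⁆≡p : x ∈ p → (p - x) ∪ ⁅ x ⁆ ≡ p
p-x∪⁅x⁆≡p {x = x} {p = p} x∈p = ⊆-antisym into onto
  where
  into : (p - x) ∪ ⁅ x ⁆ ⊆ p
  into w∈ with x∈p∪⁅y⁆⁻ w∈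
  ... | inj₁ w∈p-x = proj₁ (x∈p-y⁻ w∈p-x)
  ... | inj₂ refl = x∈p
  onto : p ⊆ (p - x) ∪ ⁅ x ⁆
  onto {w} w∈p with w ≟ᶠ x
  ... | yes refl = y∈p∪⁅y⁆
  ... | no w≢x = x∈p∪q⁺ (inj₁ (x∈p∧x≢y⇒x∈p-y w∈p w≢x))

x∈p⇒[p-x]∪q∪⁅x⁆≡p∪q : x ∈ p → ((p - x) ∪ q) ∪ ⁅ x ⁆ ≡ p ∪ q
x∈p⇒[p-x]∪q∪⁅x⁆≡p∪q {x = x} {p = p} {q = q} x∈p = begin
  ((p - x) ∪ q) ∪ ⁅ x ⁆  ≡⟨ ∪-assoc (p - x) q ⁅ x ⁆ ⟩
  (p - x) ∪ (q ∪ ⁅ x ⁆)  ≡⟨ cong ((p - x) ∪_) (∪-comm q ⁅ x ⁆) ⟩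
  (p - x) ∪ (⁅ x ⁆ ∪ q)  ≡⟨ ∪-assoc (p - x) ⁅ x ⁆ q ⟨
  ((p - x) ∪ ⁅ x ⁆) ∪ q  ≡⟨ cong (_∪ q) (p-x∪⁅x⁆≡p x∈p) ⟩
  p ∪ q                  ∎
  where open ≡-Reasoning

∣p─q∣+∣p∩q∣≡∣p∣ : ∀ (p q : Subset n) → ∣ p ─ q ∣ + ∣ p ∩ q ∣ ≡ ∣ p ∣
∣p─q∣+∣p∩q∣≡∣p∣ [] [] = refl
∣p─q∣+∣p∩q∣≡∣p∣ (inside ∷ p) (inside ∷ q) =
  trans (+-suc ∣ p ─ q ∣ ∣ p ∩ q ∣) (cong suc (∣p─q∣+∣p∩q∣≡∣p∣ p q))
∣p─q∣+∣p∩q∣≡∣p∣ (inside ∷ p) (outside ∷ q) = cong suc (∣p─q∣+∣p∩q∣≡∣p∣ p q)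
∣p─q∣+∣p∩q∣≡∣p∣ (outside ∷ p) (inside ∷ q) = ∣p─q∣+∣p∩q∣≡∣p∣ p q
∣p─q∣+∣p∩q∣≡∣p∣ (outside ∷ p) (outside ∷ q) = ∣p─q∣+∣p∩q∣≡∣p∣ p q

∣p∪q∣+∣p∩q∣≡∣p∣+∣q∣ : ∀ (p q : Subset n) → ∣ p ∪ q ∣ + ∣ p ∩ q ∣ ≡ ∣ p ∣ + ∣ q ∣
∣p∪q∣+∣p∩q∣≡∣p∣+∣q∣ [] [] = refl
∣p∪q∣+∣p∩q∣≡∣p∣+∣q∣ (inside ∷ p) (inside ∷ q) = cong suc (begin
  ∣ p ∪ q ∣ + suc ∣ p ∩ q ∣ ≡⟨ +-suc ∣ p ∪ q ∣ ∣ p ∩ q ∣ ⟩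
  suc (∣ p ∪ q ∣ + ∣ p ∩ q ∣) ≡⟨ cong suc (∣p∪q∣+∣p∩q∣≡∣p∣+∣q∣ p q) ⟩
  suc (∣ p ∣ + ∣ q ∣) ≡⟨ +-suc ∣ p ∣ ∣ q ∣ ⟨
  ∣ p ∣ + suc ∣ q ∣ ∎)
  where open ≡-Reasoning
∣p∪q∣+∣p∩q∣≡∣p∣+∣q∣ (inside ∷ p) (outside ∷ q) = cong suc (∣p∪q∣+∣p∩q∣≡∣p∣+∣q∣ p q)
∣p∪q∣+∣p∩q∣≡∣p∣+∣q∣ (outside ∷ p) (inside ∷ q) =
  trans (cong suc (∣p∪q∣+∣p∩q∣≡∣p∣+∣q∣ p q)) (sym (+-suc ∣ p ∣ ∣ q ∣))
∣p∪q∣+∣p∩q∣≡∣p∣+∣q∣ (outside ∷ p) (outside ∷ q) = ∣p∪q∣+∣p∩q∣≡∣p∣+∣q∣ p q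

∣p∪q∣≤∣p∣+∣q∣ : ∀ (p q : Subset n) → ∣ p ∪ q ∣ ≤ ∣ p ∣ + ∣ q ∣
∣p∪q∣≤∣p∣+∣q∣ p q = subst (∣ p ∪ q ∣ ≤_) (∣p∪q∣+∣p∩q∣≡∣p∣+∣q∣ p q) (m≤m+n ∣ p ∪ q ∣ ∣ p ∩ q ∣)

∣p∪⁅x⁆∣≤suc∣p∣ : ∀ (p : Subset n) x → ∣ p ∪ ⁅ x ⁆ ∣ ≤ suc ∣ p ∣
∣p∪⁅x⁆∣≤suc∣p∣ p x =
  ≤-trans (∣p∪q∣≤∣p∣+∣q∣ p ⁅ x ⁆) (≤-reflexive (trans (cong (∣ p ∣ +_) (∣⁅x⁆∣≡1 x)) (+-comm ∣ p ∣ 1)))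

Empty⇒∣p∣≡0 : ∀ {n} {p : Subset n} → Empty p → ∣ p ∣ ≡ 0
Empty⇒∣p∣≡0 {n} p-empty = trans (cong ∣_∣ (Empty-unique p-empty)) (∣⊥∣≡0 n)

x∈p⇒0<∣p∣ : x ∈ p → 0 < ∣ p ∣
x∈p⇒0<∣p∣ {x = x} x∈p = subst (_≤ _) (∣⁅x⁆∣≡1 x) (p⊆q⇒∣p∣≤∣q∣ (x∈p⇒⁅x⁆⊆p x∈p))

0<∣p∣⇒Nonempty : 0 < ∣ p ∣ → Nonempty p
0<∣p∣⇒Nonempty {p = p} 0<∣p∣ with nonempty? p
... | yes p-nonempty = p-nonempty
... | no p-empty = contradiction (Empty⇒∣p∣≡0 p-empty) (>⇒≢ 0<∣p∣)

Disjoint⇒∣p∪q∣≡∣p∣+∣q∣ : ∀ (p q : Subset n) → Disjoint p q → ∣ p ∪ q ∣ ≡ ∣ p ∣ + ∣ q ∣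
Disjoint⇒∣p∪q∣≡∣p∣+∣q∣ p q p#q = begin
  ∣ p ∪ q ∣                 ≡⟨ +-identityʳ _ ⟨
  ∣ p ∪ q ∣ + 0             ≡⟨ cong (∣ p ∪ q ∣ +_) (Empty⇒∣p∣≡0 p∩q-empty) ⟨
  ∣ p ∪ q ∣ + ∣ p ∩ q ∣     ≡⟨ ∣p∪q∣+∣p∩q∣≡∣p∣+∣q∣ p q ⟩
  ∣ p ∣ + ∣ q ∣             ∎
  where
  open ≡-Reasoning
  p∩q-empty : Empty (p ∩ q)
  p∩q-empty (x , x∈p∩q) = let x∈p , x∈q = x∈p∩q⁻ p q x∈p∩q in p#q x∈p x∈q

∣p─q∣+∣q∣≡∣p∣ : q ⊆ p → ∣ p ─ q ∣ + ∣ q ∣ ≡ ∣ p ∣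
∣p─q∣+∣q∣≡∣p∣ {q = q} {p = p} q⊆p =
  trans (cong (λ r → ∣ p ─ q ∣ + ∣ r ∣) (sym p∩q≡q)) (∣p─q∣+∣p∩q∣≡∣p∣ p q)
  where
  p∩q≡q : p ∩ q ≡ q
  p∩q≡q = ⊆-antisym (λ {x} → proj₂ ∘ x∈p∩q⁻ p q) (λ x∈q → x∈p∩q⁺ (q⊆p x∈q , x∈q))

∣p─[q∪r]∣≤∣p─q∣ : ∀ (p q r : Subset n) → ∣ p ─ (q ∪ r) ∣ ≤ ∣ p ─ q ∣
∣p─[q∪r]∣≤∣p─q∣ p q r = subst (λ s → ∣ s ∣ ≤ ∣ p ─ q ∣) (p─q─r≡p─q∪r p q r) (∣p─q∣≤∣p∣ (p ─ q) r)

∣p─[q∪r]∣+∣r∣≡∣p─q∣ : r ⊆ p ─ q → ∣ p ─ (q ∪ r) ∣ + ∣ r ∣ ≡ ∣ p ─ q ∣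
∣p─[q∪r]∣+∣r∣≡∣p─q∣ {r = r} {p = p} {q = q} r⊆p─q =
  trans (cong (λ s → ∣ s ∣ + ∣ r ∣) (sym (p─q─r≡p─q∪r p q r))) (∣p─q∣+∣q∣≡∣p∣ r⊆p─q)

x∈p⇒suc∣p-x∣≡∣p∣ : x ∈ p → suc ∣ p - x ∣ ≡ ∣ p ∣
x∈p⇒suc∣p-x∣≡∣p∣ {x = x} {p = p} x∈p = begin
  suc ∣ p - x ∣          ≡⟨ +-comm 1 _ ⟩
  ∣ p - x ∣ + 1          ≡⟨ cong (∣ p - x ∣ +_) (∣⁅x⁆∣≡1 x) ⟨
  ∣ p - x ∣ + ∣ ⁅ x ⁆ ∣  ≡⟨ ∣p─q∣+∣q∣≡∣p∣ (x∈p⇒⁅x⁆⊆p x∈p) ⟩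
  ∣ p ∣                  ∎
  where open ≡-Reasoning

x∉p⇒∣p∪⁅x⁆∣≡suc∣p∣ : x ∉ p → ∣ p ∪ ⁅ x ⁆ ∣ ≡ suc ∣ p ∣
x∉p⇒∣p∪⁅x⁆∣≡suc∣p∣ {x = x} {p = p} x∉p = begin
  ∣ p ∪ ⁅ x ⁆ ∣      ≡⟨ Disjoint⇒∣p∪q∣≡∣p∣+∣q∣ p ⁅ x ⁆ p#⁅x⁆ ⟩
  ∣ p ∣ + ∣ ⁅ x ⁆ ∣  ≡⟨ cong (∣ p ∣ +_) (∣⁅x⁆∣≡1 x) ⟩
  ∣ p ∣ + 1          ≡⟨ +-comm ∣ p ∣ 1 ⟩
  suc ∣ p ∣          ∎
  where
  open ≡-Reasoning
  p#⁅x⁆ : Disjoint p ⁅ x ⁆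
  p#⁅x⁆ w∈p w∈⁅x⁆ = x∉p (subst (_∈ p) (x∈⁅y⁆⇒x≡y x w∈⁅x⁆) w∈p)

x≢y⇒∣⁅x⁆∪⁅y⁆∣≡2 : x ≢ y → ∣ ⁅ x ⁆ ∪ ⁅ y ⁆ ∣ ≡ 2
x≢y⇒∣⁅x⁆∪⁅y⁆∣≡2 {x = x} {y = y} x≢y =
  trans (x∉p⇒∣p∪⁅x⁆∣≡suc∣p∣ (x≢y ∘ sym ∘ x∈⁅y⁆⇒x≡y x)) (cong suc (∣⁅x⁆∣≡1 x))

x∈p∧y∉p⇒∣[p-x]∪⁅y⁆∣≡∣p∣ : x ∈ p → y ∉ p → ∣ (p - x) ∪ ⁅ y ⁆ ∣ ≡ ∣ p ∣
x∈p∧y∉p⇒∣[p-x]∪⁅y⁆∣≡∣p∣ x∈p y∉p =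
  trans (x∉p⇒∣p∪⁅x⁆∣≡suc∣p∣ (y∉p ∘ proj₁ ∘ x∈p-y⁻)) (x∈p⇒suc∣p-x∣≡∣p∣ x∈p)

∣p∣≤1∧x∈p∧y∈p⇒x≡y : ∣ p ∣ ≤ 1 → x ∈ p → y ∈ p → x ≡ y
∣p∣≤1∧x∈p∧y∈p⇒x≡y {p = p} {x = x} {y = y} ∣p∣≤1 x∈p y∈p with y ≟ᶠ x
... | yes y≡x = sym y≡x
... | no y≢x = contradiction ∣p∣≤1 (<⇒≱ (begin-strict
  1              ≤⟨ x∈p⇒0<∣p∣ (x∈p∧x≢y⇒x∈p-y y∈p y≢x) ⟩
  ∣ p - x ∣      <⟨ n<1+n _ ⟩
  suc ∣ p - x ∣  ≡⟨ x∈p⇒suc∣p-x∣≡∣p∣ x∈p ⟩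
  ∣ p ∣          ∎))
  where open ≤-Reasoning

∣p─q∣≡0⇒p⊆q : ∣ p ─ q ∣ ≡ 0 → p ⊆ q
∣p─q∣≡0⇒p⊆q {p = p} {q = q} ∣p─q∣≡0 {x} x∈p with x ∈? q
... | yes x∈q = x∈q
... | no x∉q = contradiction ∣p─q∣≡0 (>⇒≢ (x∈p⇒0<∣p∣ (x∈p∧x∉q⇒x∈p─q x∈p x∉q)))

p⊆q⇒∣q∣≤∣p∣⇒p≡q : p ⊆ q → ∣ q ∣ ≤ ∣ p ∣ → p ≡ q
p⊆q⇒∣q∣≤∣p∣⇒p≡q {p = p} {q = q} p⊆q ∣q∣≤∣p∣ =
  ⊆-antisym p⊆q (∣p─q∣≡0⇒p⊆q (+-cancelʳ-≡ ∣ p ∣ _ 0 (begin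
    ∣ q ─ p ∣ + ∣ p ∣  ≡⟨ ∣p─q∣+∣q∣≡∣p∣ p⊆q ⟩
    ∣ q ∣              ≡⟨ ≤-antisym ∣q∣≤∣p∣ (p⊆q⇒∣p∣≤∣q∣ p⊆q) ⟩
    ∣ p ∣              ∎)))
  where open ≡-Reasoning

p⊆q∧∣q∣≡suc∣p∣⇒q≡p∪⁅x⁆ : p ⊆ q → ∣ q ∣ ≡ suc ∣ p ∣ → ∃[ x ] x ∉ p × q ≡ p ∪ ⁅ x ⁆
p⊆q∧∣q∣≡suc∣p∣⇒q≡p∪⁅x⁆ {p = p} {q = q} p⊆q ∣q∣≡1+∣p∣ =
  let x , x∈q─p = 0<∣p∣⇒Nonempty (subst (0 <_) (sym ∣q─p∣≡1) (s≤s z≤n))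
      x∈q , x∉p = x∈p─q⁻ x∈q─p
  in x , x∉p , sym (p⊆q⇒∣q∣≤∣p∣⇒p≡q (∪-lub p⊆q (x∈p⇒⁅x⁆⊆p x∈q))
                 (≤-reflexive (trans ∣q∣≡1+∣p∣ (sym (x∉p⇒∣p∪⁅x⁆∣≡suc∣p∣ x∉p)))))
  where
  ∣q─p∣≡1 : ∣ q ─ p ∣ ≡ 1
  ∣q─p∣≡1 = +-cancelʳ-≡ ∣ p ∣ _ 1 (trans (∣p─q∣+∣q∣≡∣p∣ p⊆q) ∣q∣≡1+∣p∣)

∣p∣≡∣q∣⇒∣p─q∣≡∣q─p∣ : ∀ (p q : Subset n) → ∣ p ∣ ≡ ∣ q ∣ → ∣ p ─ q ∣ ≡ ∣ q ─ p ∣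
∣p∣≡∣q∣⇒∣p─q∣≡∣q─p∣ p q ∣p∣≡∣q∣ = +-cancelʳ-≡ _ _ _ (begin
  ∣ p ─ q ∣ + ∣ p ∩ q ∣  ≡⟨ ∣p─q∣+∣p∩q∣≡∣p∣ p q ⟩
  ∣ p ∣                  ≡⟨ ∣p∣≡∣q∣ ⟩
  ∣ q ∣                  ≡⟨ ∣p─q∣+∣p∩q∣≡∣p∣ q p ⟨
  ∣ q ─ p ∣ + ∣ q ∩ p ∣  ≡⟨ cong (λ r → ∣ q ─ p ∣ + ∣ r ∣) (∩-comm q p) ⟩
  ∣ q ─ p ∣ + ∣ p ∩ q ∣  ∎)
  where open ≡-Reasoning

∣p∣≡∣q∣⇒Nonempty[p─q]⇒Nonempty[q─p] : ∀ (p q : Subset n) → ∣ p ∣ ≡ ∣ q ∣ → Nonempty (p ─ q) → Nonempty (q ─ p)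
∣p∣≡∣q∣⇒Nonempty[p─q]⇒Nonempty[q─p] p q ∣p∣≡∣q∣ (x , x∈p─q) =
  0<∣p∣⇒Nonempty (subst (0 <_) (∣p∣≡∣q∣⇒∣p─q∣≡∣q─p∣ p q ∣p∣≡∣q∣) (x∈p⇒0<∣p∣ x∈p─q))

∣[p-x]∪⁅y⁆─q∣<∣p─q∣ : x ∈ p ─ q → y ∈ q → ∣ ((p - x) ∪ ⁅ y ⁆) ─ q ∣ < ∣ p ─ q ∣
∣[p-x]∪⁅y⁆─q∣<∣p─q∣ {x = x} {p = p} {q = q} {y = y} x∈p─q y∈q =
  ≤-<-trans (p⊆q⇒∣p∣≤∣q∣ shrinks) (x∈p⇒∣p-x∣<∣p∣ x∈p─q)
  where
  shrinks : ((p - x) ∪ ⁅ y ⁆) ─ q ⊆ (p ─ q) - x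
  shrinks w∈ with x∈p─q⁻ w∈
  ... | w∈p-x∪⁅y⁆ , w∉q with x∈p∪⁅y⁆⁻ w∈p-x∪⁅y⁆
  ... | inj₂ refl = contradiction y∈q w∉q
  ... | inj₁ w∈p-x = let w∈p , w≢x = x∈p-y⁻ w∈p-x in x∈p∧x≢y⇒x∈p-y (x∈p∧x∉q⇒x∈p─q w∈p w∉q) w≢x

∃⊆-ofSize : ∀ {n} (p : Subset n) {m} → m ≤ ∣ p ∣ → ∃[ q ] q ⊆ p × ∣ q ∣ ≡ m
∃⊆-ofSize {n} p {zero} _ = ∅ , ⊥⊆ , ∣⊥∣≡0 n
∃⊆-ofSize (outside ∷ p) {suc m} m<∣p∣ =
  let q , q⊆p , ∣q∣≡m = ∃⊆-ofSize p m<∣p∣ in outside ∷ q , out⊆ q⊆p , ∣q∣≡m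
∃⊆-ofSize (inside ∷ p) {suc m} (s≤s m≤∣p∣) =
  let q , q⊆p , ∣q∣≡m = ∃⊆-ofSize p m≤∣p∣ in inside ∷ q , s⊆s q⊆p , cong suc ∣q∣≡m

∃-ofSize : ∀ {n m} → m ≤ n → ∃ λ (S : Subset n) → ∣ S ∣ ≡ m
∃-ofSize {n} {m} m≤n =
  let S , _ , ∣S∣≡m = ∃⊆-ofSize (⊤ {n}) (subst (m ≤_) (sym (∣⊤∣≡n n)) m≤n) in S , ∣S∣≡m

∃-disjoint-ofSize : ∀ (W : Subset n) {m} → m + ∣ W ∣ ≤ n → ∃[ S ] ∣ S ∣ ≡ m × Disjoint S W
∃-disjoint-ofSize W {m} m+∣W∣≤n =
  let S , S⊆∁W , ∣S∣≡m = ∃⊆-ofSize (∁ W) m≤∣∁W∣ in S , ∣S∣≡m , λ x∈S → x∈∁p⇒x∉p (S⊆∁W x∈S)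
  where
  m≤∣∁W∣ : m ≤ ∣ ∁ W ∣
  m≤∣∁W∣ = subst (m ≤_) (sym (∣∁p∣≡n∸∣p∣ W)) (m+n≤o⇒m≤o∸n m m+∣W∣≤n)

swap-walk : ∀ {n} (P : Subset n → Set) (q : Subset n) →
            (∀ {p x y} → P p → x ∈ p ─ q → y ∈ q ─ p → P ((p - x) ∪ ⁅ y ⁆)) →
            ∀ {p} → ∣ p ∣ ≡ ∣ q ∣ → P p → P q
swap-walk P q swap {p} ∣p∣≡∣q∣ Pp = go p ∣p∣≡∣q∣ Pp (<-wellFounded ∣ p ─ q ∣)
  where
  go : ∀ p → ∣ p ∣ ≡ ∣ q ∣ → P p → Acc _<_ ∣ p ─ q ∣ → P q
  go p ∣p∣≡∣q∣ Pp (acc smaller) with nonempty? (p ─ q)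
  ... | no p⊆q = subst P (p⊆q⇒∣q∣≤∣p∣⇒p≡q (∣p─q∣≡0⇒p⊆q (Empty⇒∣p∣≡0 p⊆q)) (≤-reflexive (sym ∣p∣≡∣q∣))) Pp
  ... | yes (x , x∈p─q) =
        let y , y∈q─p = ∣p∣≡∣q∣⇒Nonempty[p─q]⇒Nonempty[q─p] p q ∣p∣≡∣q∣ (x , x∈p─q)
            y∈q , y∉p = x∈p─q⁻ y∈q─p
        in go ((p - x) ∪ ⁅ y ⁆)
              (trans (x∈p∧y∉p⇒∣[p-x]∪⁅y⁆∣≡∣p∣ (proj₁ (x∈p─q⁻ x∈p─q)) y∉p) ∣p∣≡∣q∣)
              (swap Pp x∈p─q y∈q─p) (smaller (∣[p-x]∪⁅y⁆─q∣<∣p─q∣ x∈p─q y∈q))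

-- Counting supersets

∈-allSubsets : ∀ {n} (S : Subset n) → S ∈ˡ allSubsets n
∈-allSubsets [] = here refl
∈-allSubsets {suc n} (outside ∷ S) = ∈-++⁺ˡ (∈-map⁺ (outside ∷_) (∈-allSubsets S))
∈-allSubsets {suc n} (inside ∷ S) =
  ∈-++⁺ʳ (map (outside ∷_) (allSubsets n)) (∈-map⁺ (inside ∷_) (∈-allSubsets S))

allSubsets-unique : ∀ n → Unique (allSubsets n)
allSubsets-unique zero = [] ∷ []
allSubsets-unique (suc n) = Unique.++⁺ (Unique.map⁺ ∷-injectiveʳ (allSubsets-unique n))
  (Unique.map⁺ ∷-injectiveʳ (allSubsets-unique n)) outside≢inside
  where
  ∷-injectiveʳ : ∀ {b} {S T : Subset n} → _≡_ {A = Subset (suc n)} (b ∷ S) (b ∷ T) → S ≡ T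
  ∷-injectiveʳ refl = refl
  outside≢inside : ∀ {U} →
                   U ∈ˡ map (outside ∷_) (allSubsets n) × U ∈ˡ map (inside ∷_) (allSubsets n) → ⊥
  outside≢inside (U∈outs , U∈ins) with ∈-map⁻ (outside ∷_) U∈outs | ∈-map⁻ (inside ∷_) U∈ins
  ... | _ , _ , refl | _ , _ , ()

Unique∧constant⇒length≤1 : ∀ {A : Set} {xs : List A} {x₀} →
                           Unique xs → (∀ {x} → x ∈ˡ xs → x ≡ x₀) → length xs ≤ 1
Unique∧constant⇒length≤1 {xs = []} _ _ = z≤n
Unique∧constant⇒length≤1 {xs = _ ∷ []} _ _ = ≤-refl
Unique∧constant⇒length≤1 {xs = _ ∷ _ ∷ _} ((x≢y ∷ _) ∷ _) ≡x₀ =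
  contradiction (trans (≡x₀ (here refl)) (sym (≡x₀ (there (here refl))))) x≢y

0<length⇒∃∈ : ∀ {A : Set} {xs : List A} → 0 < length xs → ∃[ x ] x ∈ˡ xs
0<length⇒∃∈ {xs = x ∷ _} _ = x , here refl

module _ {n : ℕ} (F : Family n) (S : Subset n) where

  isSupersetIn : Subset n → Bool
  isSupersetIn T = F T ∧ ⌊ S ⊆? T ⌋

  isSupersetIn? : ∀ T → Dec (isSupersetIn T ≡ true)
  isSupersetIn? T = isSupersetIn T ≟ᵇ true

  isSupersetIn⇔ : ∀ T → isSupersetIn T ≡ true ⇔ (T ∈F F × S ⊆ T)
  isSupersetIn⇔ T with F T | S ⊆? T
  ... | true  | yes S⊆T = mk⇔ (λ _ → refl , λ {x} → S⊆T {x}) (λ _ → refl)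
  ... | true  | no S⊈T  = mk⇔ (λ ()) (λ (_ , S⊆T) → contradiction (λ {x} → S⊆T {x}) S⊈T)
  ... | false | _       = mk⇔ (λ ()) (λ { (() , _) })

  ∈-supersets⁻ : ∀ {T} → T ∈ˡ filter isSupersetIn? (allSubsets n) → T ∈F F × S ⊆ T
  ∈-supersets⁻ {T} T∈ =
    Equivalence.to (isSupersetIn⇔ T) (proj₂ (∈-filter⁻ isSupersetIn? {xs = allSubsets n} T∈))

  0<degree⇒∃superset : 0 < degree F S → ∃[ T ] T ∈F F × S ⊆ T
  0<degree⇒∃superset 0<deg = let T , T∈ = 0<length⇒∃∈ 0<deg in T , ∈-supersets⁻ T∈

  superset⇒0<degree : ∀ {T} → T ∈F F → S ⊆ T → 0 < degree F S
  superset⇒0<degree {T} T∈F S⊆T =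
    ∈-length (∈-filter⁺ isSupersetIn? (∈-allSubsets T)
                        (Equivalence.from (isSupersetIn⇔ T) (T∈F , λ {x} → S⊆T {x})))

  unique-superset⇒degree≤1 : ∀ {T₀} → (∀ {T} → T ∈F F → S ⊆ T → T ≡ T₀) → degree F S ≤ 1
  unique-superset⇒degree≤1 unique = Unique∧constant⇒length≤1
    (Unique.filter⁺ isSupersetIn? (allSubsets-unique n))
    (λ T∈ → let T∈F , S⊆T = ∈-supersets⁻ T∈ in unique T∈F S⊆T)

minList≤ : ∀ {xs : List ℕ} {x} → x ∈ˡ xs → minList xs ≤ x
minList≤ {_ ∷ []} (here refl) = ≤-refl
minList≤ {x ∷ _ ∷ _} (here refl) = m⊓n≤m x _
minList≤ {x ∷ y ∷ ys} (there x∈) = ≤-trans (m⊓n≤n x _) (minList≤ {y ∷ ys} x∈)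

≤minList : ∀ {xs : List ℕ} {b x} → x ∈ˡ xs → (∀ {y} → y ∈ˡ xs → b ≤ y) → b ≤ minList xs
≤minList {_ ∷ []} _ b≤ = b≤ (here refl)
≤minList {_ ∷ y ∷ _} _ b≤ = ⊓-glb (b≤ (here refl)) (≤minList (here refl) (b≤ ∘ there))

module _ {n : ℕ} (F : Family n) where

  minDegree≤degree : ∀ {d S} → ∣ S ∣ ≡ d → minDegree d F ≤ degree F S
  minDegree≤degree {d} {S} ∣S∣≡d =
    minList≤ (∈-map⁺ (degree F) (∈-filter⁺ (λ S → ∣ S ∣ ≟ d) (∈-allSubsets S) ∣S∣≡d))

  ≤minDegree : ∀ {d b} → ∃[ S₀ ] ∣ S₀ ∣ ≡ d → (∀ {S} → ∣ S ∣ ≡ d → b ≤ degree F S) →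
               b ≤ minDegree d F
  ≤minDegree {d} {b} (S₀ , ∣S₀∣≡d) b≤degree =
    ≤minList (∈-map⁺ (degree F) (∈-filter⁺ (λ S → ∣ S ∣ ≟ d) (∈-allSubsets S₀) ∣S₀∣≡d)) λ y∈ →
      let S , S∈ , y≡ = ∈-map⁻ (degree F) y∈
      in subst (b ≤_) (sym y≡)
               (b≤degree (proj₂ (∈-filter⁻ (λ S → ∣ S ∣ ≟ d) {xs = allSubsets n} S∈)))

-- Families in which every K-set lies in a member

FullShadow : {n : ℕ} → ℕ → Family n → Set
FullShadow K F = ∀ S → ∣ S ∣ ≡ K → ∃[ z ] z ∉ S × (S ∪ ⁅ z ⁆) ∈F F

1≤minDegree⇒FullShadow : ∀ {n K} {F : Family n} →
                         IsUniform (suc K) F → 1 ≤ minDegree K F → FullShadow K F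
1≤minDegree⇒FullShadow {F = F} uniform 1≤δ S ∣S∣≡K =
  let T , T∈F , S⊆T = 0<degree⇒∃superset F S (≤-trans 1≤δ (minDegree≤degree F ∣S∣≡K))
      z , z∉S , T≡S∪z = p⊆q∧∣q∣≡suc∣p∣⇒q≡p∪⁅x⁆ S⊆T (trans (uniform T T∈F) (cong suc (sym ∣S∣≡K)))
  in z , z∉S , subst (_∈F F) T≡S∪z T∈F

m*[1+m]<n*[1+n]⇒m<n : ∀ {m n} → m * suc m < n * suc n → m < n
m*[1+m]<n*[1+n]⇒m<n lt = ≰⇒> λ n≤m → <⇒≱ lt (*-mono-≤ n≤m (s≤s n≤m))

module WithFullShadow {n K t : ℕ} {F : Family n} (uniform : IsUniform (suc K) F)
    (intersecting : IsIntersecting F) (full : FullShadow K F)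
    (t-ceil : 2 * suc K ≤ t * (t + 1)) (n-large : 2 * suc K + t + 3 ≤ n) where

  k : ℕ
  k = suc K

  1+k≤k+t+1 : suc k ≤ k + t + 1
  1+k≤k+t+1 = ≤-trans (≤-reflexive (+-comm 1 k)) (+-monoˡ-≤ 1 (m≤m+n k t))

  fresh : ∀ W → ∣ W ∣ ≤ k + t + 1 → ∃[ S ] ∣ S ∣ ≡ K × Disjoint S W
  fresh W small = ∃-disjoint-ofSize W (≤-trans (+-monoʳ-≤ K small) room)
    where
    room : K + (k + t + 1) ≤ n
    room = ≤-trans (m≤m+n _ 3) (≤-trans (≤-reflexive (shift K t)) n-large)
      where
      shift : ∀ K t → K + (suc K + t + 1) + 3 ≡ 2 * suc K + t + 3
      shift = solve-∀

  added-point-∈ : ∀ {T G z} → (T ∪ ⁅ z ⁆) ∈F F → G ∈F F → Disjoint T G → z ∈ G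
  added-point-∈ {T} {G} {z} T+z∈F G∈F T#G with intersecting _ _ T+z∈F G∈F
  ... | w , w∈∩ with x∈p∩q⁻ (T ∪ ⁅ z ⁆) G w∈∩
  ... | w∈T+z , w∈G with x∈p∪⁅y⁆⁻ w∈T+z
  ... | inj₁ w∈T = contradiction w∈G (T#G w∈T)
  ... | inj₂ refl = w∈G

  AvoidedWithin : Subset n → Fin n → Set
  AvoidedWithin W a = ∃[ M ] M ∈F F × M ⊆ W × a ∉ M

  AvoidedWithin-mono : ∀ {W W′ a} → W ⊆ W′ → AvoidedWithin W a → AvoidedWithin W′ a
  AvoidedWithin-mono W⊆W′ (M , M∈F , M⊆W , a∉M) = M , M∈F , W⊆W′ ∘ M⊆W , a∉M

  ¬all-avoided : ∀ {A W} → A ∈F F → A ⊆ W → ∣ W ∣ ≤ k + t + 1 →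
                 ¬ (∀ {a} → a ∈ A → AvoidedWithin W a)
  ¬all-avoided {A} {W} A∈F A⊆W small avoided =
    let T , ∣T∣≡K , T#W = fresh W small
        z , _ , T+z∈F = full T ∣T∣≡K
        M , M∈F , M⊆W , z∉M = avoided (added-point-∈ T+z∈F A∈F λ w∈T → T#W w∈T ∘ A⊆W)
    in z∉M (added-point-∈ T+z∈F M∈F λ w∈T → T#W w∈T ∘ M⊆W)

  -- Trading D ⊆ A for Y completes the K-set (A ─ D) ∪ Y by a point z; the new member avoids D − z.
  data TradeOutcome (A Y D : Subset n) (z : Fin n) : Set where
    reenters : z ∈ D → (∀ {a} → a ∈ D - z → AvoidedWithin (A ∪ Y) a) → TradeOutcome A Y D z
    escapes  : z ∉ A → z ∉ Y → (∀ {a} → a ∈ D → AvoidedWithin (A ∪ (Y ∪ ⁅ z ⁆)) a) →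
               TradeOutcome A Y D z

  trade : ∀ {A Y D} → A ∈F F → Disjoint Y A → D ⊆ A → ∣ D ∣ ≡ suc ∣ Y ∣ →
          ∃[ z ] (((A ─ D) ∪ Y) ∪ ⁅ z ⁆) ∈F F × TradeOutcome A Y D z
  trade {A} {Y} {D} A∈F Y#A D⊆A ∣D∣≡1+∣Y∣ with full ((A ─ D) ∪ Y) ∣T∣≡K
    where
    open ≡-Reasoning
    ∣T∣≡K : ∣ (A ─ D) ∪ Y ∣ ≡ K
    ∣T∣≡K = suc-injective (begin
      suc ∣ (A ─ D) ∪ Y ∣      ≡⟨ cong suc (Disjoint⇒∣p∪q∣≡∣p∣+∣q∣ (A ─ D) Y λ h h′ → Y#A h′ (p─q⊆p A D h)) ⟩
      suc (∣ A ─ D ∣ + ∣ Y ∣)  ≡⟨ +-suc ∣ A ─ D ∣ ∣ Y ∣ ⟨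
      ∣ A ─ D ∣ + suc ∣ Y ∣    ≡⟨ cong (∣ A ─ D ∣ +_) ∣D∣≡1+∣Y∣ ⟨
      ∣ A ─ D ∣ + ∣ D ∣        ≡⟨ ∣p─q∣+∣q∣≡∣p∣ D⊆A ⟩
      ∣ A ∣                    ≡⟨ uniform A A∈F ⟩
      suc K                    ∎)
  ... | z , z∉T , M∈F = z , M∈F , outcome
    where
    T⊆A∪Y : (A ─ D) ∪ Y ⊆ A ∪ Y
    T⊆A∪Y = ∪-lub (λ h → x∈p∪q⁺ (inj₁ (p─q⊆p A D h))) (λ h → x∈p∪q⁺ (inj₂ h))
    avoids : ∀ {a} → a ∈ D → a ≢ z → a ∉ ((A ─ D) ∪ Y) ∪ ⁅ z ⁆
    avoids a∈D a≢z a∈M with x∈p∪⁅y⁆⁻ a∈M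
    ... | inj₂ a≡z = a≢z a≡z
    ... | inj₁ a∈T with x∈p∪q⁻ (A ─ D) Y a∈T
    ... | inj₁ a∈A─D = proj₂ (x∈p─q⁻ a∈A─D) a∈D
    ... | inj₂ a∈Y = Y#A a∈Y (D⊆A a∈D)
    outcome : TradeOutcome A Y D z
    outcome with z ∈? A
    ... | yes z∈A = reenters z∈D λ a∈D-z →
          let a∈D , a≢z = x∈p-y⁻ a∈D-z
          in _ , M∈F , ∪-lub T⊆A∪Y (x∈p⇒⁅x⁆⊆p (x∈p∪q⁺ (inj₁ z∈A))) , avoids a∈D a≢z
      where
      z∈D : z ∈ D
      z∈D with z ∈? D
      ... | yes z∈D = z∈D
      ... | no z∉D = contradiction (x∈p∪q⁺ (inj₁ (x∈p∧x∉q⇒x∈p─q z∈A z∉D))) z∉T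
    ... | no z∉A = escapes z∉A (z∉T ∘ x∈p∪q⁺ ∘ inj₂) λ a∈D →
          _ , M∈F , ∪-lub (∪-monoʳ-⊆ (p⊆p∪q ⁅ z ⁆) ∘ T⊆A∪Y) (x∈p⇒⁅x⁆⊆p (x∈p∪q⁺ (inj₂ y∈p∪⁅y⁆))) ,
          avoids a∈D λ { refl → z∉A (D⊆A a∈D) }

  module Exchange {A G : Subset n} {g y : Fin n} (A∈F : A ∈F F) (G∈F : G ∈F F) (g∈A : g ∈ A)
      (A∩G⊆g : ∀ {w} → w ∈ A → w ∈ G → w ≡ g) (y∉A : y ∉ A) (y∉G : y ∉ G) where

    ∣A∣≡k : ∣ A ∣ ≡ k
    ∣A∣≡k = uniform A A∈F

    pair⊆A : ∀ {e} → e ∈ A → ⁅ e ⁆ ∪ ⁅ g ⁆ ⊆ A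
    pair⊆A e∈A = ∪-lub (x∈p⇒⁅x⁆⊆p e∈A) (x∈p⇒⁅x⁆⊆p g∈A)

    -- The added point lies in G, as the traded K-set misses G; so it is g or lies outside A.
    pair-trade : ∀ {e} → e ∈ A → e ≢ g →
                 ((A - e) ∪ ⁅ y ⁆) ∈F F
                 ⊎ ∃[ z ] z ∉ A × z ≢ y ×
                     (∀ {a} → a ∈ ⁅ e ⁆ ∪ ⁅ g ⁆ → AvoidedWithin (A ∪ (⁅ y ⁆ ∪ ⁅ z ⁆)) a)
    pair-trade {e} e∈A e≢g with trade A∈F (x∉p⇒Disjoint⁅x⁆p y∉A) (pair⊆A e∈A)
                                 (trans (x≢y⇒∣⁅x⁆∪⁅y⁆∣≡2 e≢g) (cong suc (sym (∣⁅x⁆∣≡1 y))))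
    ... | z , _ , escapes z∉A z∉⁅y⁆ avoided = inj₂ (z , z∉A , (λ { refl → z∉⁅y⁆ (x∈⁅x⁆ z) }) , avoided)
    ... | z , M∈F , reenters z∈D _ = inj₁ (subst (_∈F F) M≡A-e∪y M∈F)
      where
      D : Subset n
      D = ⁅ e ⁆ ∪ ⁅ g ⁆
      T#G : Disjoint ((A ─ D) ∪ ⁅ y ⁆) G
      T#G w∈T w∈G with x∈p∪⁅y⁆⁻ w∈T
      ... | inj₂ refl = y∉G w∈G
      ... | inj₁ w∈A─D = let w∈A , w∉D = x∈p─q⁻ w∈A─D in
                         w∉D (x∈p∪q⁺ (inj₂ (subst (_∈ ⁅ g ⁆) (sym (A∩G⊆g w∈A w∈G)) (x∈⁅x⁆ g))))
      z≡g : z ≡ g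
      z≡g = A∩G⊆g (pair⊆A e∈A z∈D) (added-point-∈ M∈F G∈F T#G)
      M≡A-e∪y : ((A ─ D) ∪ ⁅ y ⁆) ∪ ⁅ z ⁆ ≡ (A - e) ∪ ⁅ y ⁆
      M≡A-e∪y rewrite z≡g | sym (p─q─r≡p─q∪r A ⁅ e ⁆ ⁅ g ⁆) =
        x∈p⇒[p-x]∪q∪⁅x⁆≡p∪q (x∈p∧x≢y⇒x∈p-y g∈A (e≢g ∘ sym))

    -- As 2k ≤ t(t + 1), the budget keeps |Y| ≤ t, and it pays for each trade: either |Y| more points
    -- of A are avoided, or Y grows by one and |Y| + 1 points are avoided.
    record State : Set where
      field
        Y C     : Subset n
        Y#A     : Disjoint Y A
        y∈Y     : y ∈ Y
        g∈C     : g ∈ C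
        avoided : ∀ {a} → a ∈ C → AvoidedWithin (A ∪ Y) a
        budget  : 2 * ∣ A ─ C ∣ + ∣ Y ∣ * suc ∣ Y ∣ ≤ 2 * k + 2

    uncovered : State → ℕ
    uncovered s = ∣ A ─ State.C s ∣

    module _ (s : State) where
      open State s

      ∣Y∣≤t : ∣ Y ∣ ≤ t
      ∣Y∣≤t = ≤-pred (m*[1+m]<n*[1+n]⇒m<n (begin-strict
        ∣ Y ∣ * suc ∣ Y ∣          ≤⟨ m+n≤o⇒n≤o (2 * ∣ A ─ C ∣) budget ⟩
        2 * k + 2                  ≤⟨ +-monoˡ-≤ 2 (≤-trans t-ceil (≤-reflexive (cong (t *_) (+-comm t 1)))) ⟩
        t * suc t + 2              <⟨ +-monoʳ-< (t * suc t) (≤-trans (n≤1+n 3) (*-monoʳ-≤ 2 (s≤s 1≤t))) ⟩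
        t * suc t + 2 * suc t      ≡⟨ square-step t ⟩
        suc t * suc (suc t)        ∎))
        where
        open ≤-Reasoning
        1≤t : 1 ≤ t
        1≤t = n≢0⇒n>0 λ t≡0 → contradiction (subst (λ s → 2 * k ≤ s * (s + 1)) t≡0 t-ceil) λ ()
        square-step : ∀ t → t * suc t + 2 * suc t ≡ suc t * suc (suc t)
        square-step = solve-∀

      ¬all-avoided-within : ∀ z → ¬ (∀ {a} → a ∈ A → AvoidedWithin (A ∪ (Y ∪ ⁅ z ⁆)) a)
      ¬all-avoided-within z = ¬all-avoided A∈F (λ a∈A → x∈p∪q⁺ (inj₁ a∈A)) (begin
        ∣ A ∪ (Y ∪ ⁅ z ⁆) ∣          ≤⟨ ∣p∪q∣≤∣p∣+∣q∣ A (Y ∪ ⁅ z ⁆) ⟩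
        ∣ A ∣ + ∣ Y ∪ ⁅ z ⁆ ∣        ≤⟨ +-mono-≤ (≤-reflexive ∣A∣≡k) (∣p∪q∣≤∣p∣+∣q∣ Y ⁅ z ⁆) ⟩
        k + (∣ Y ∣ + ∣ ⁅ z ⁆ ∣)      ≡⟨ cong (λ c → k + (∣ Y ∣ + c)) (∣⁅x⁆∣≡1 z) ⟩
        k + (∣ Y ∣ + 1)              ≤⟨ +-monoʳ-≤ k (+-monoˡ-≤ 1 ∣Y∣≤t) ⟩
        k + (t + 1)                  ≡⟨ +-assoc k t 1 ⟨
        k + t + 1                    ∎)
        where open ≤-Reasoning

      A∪Y⊆A∪[Y∪⁅z⁆] : ∀ {z} → A ∪ Y ⊆ A ∪ (Y ∪ ⁅ z ⁆)
      A∪Y⊆A∪[Y∪⁅z⁆] {z} = ∪-monoʳ-⊆ (p⊆p∪q ⁅ z ⁆)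

      absorb : ∀ X → (∀ {a} → a ∈ X → AvoidedWithin (A ∪ Y) a) → State
      absorb X avoidedX = record
        { Y = Y ; C = C ∪ X ; Y#A = Y#A ; y∈Y = y∈Y ; g∈C = x∈p∪q⁺ (inj₁ g∈C)
        ; avoided = λ a∈C∪X → [ avoided , avoidedX ]′ (x∈p∪q⁻ C X a∈C∪X)
        ; budget = ≤-trans (+-monoˡ-≤ _ (*-monoʳ-≤ 2 (∣p─[q∪r]∣≤∣p─q∣ A C X))) budget
        }

      extend : ∀ z X → z ∉ A → z ∉ Y → X ⊆ A ─ C → ∣ X ∣ ≡ suc ∣ Y ∣ →
               (∀ {a} → a ∈ X → AvoidedWithin (A ∪ (Y ∪ ⁅ z ⁆)) a) → State
      extend z X z∉A z∉Y X⊆A─C ∣X∣≡1+∣Y∣ avoidedX = record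
        { Y = Y ∪ ⁅ z ⁆ ; C = C ∪ X
        ; Y#A = Disjoint-∪ Y#A (x∉p⇒Disjoint⁅x⁆p z∉A)
        ; y∈Y = x∈p∪q⁺ (inj₁ y∈Y) ; g∈C = x∈p∪q⁺ (inj₁ g∈C)
        ; avoided = λ a∈C∪X → [ AvoidedWithin-mono A∪Y⊆A∪[Y∪⁅z⁆] ∘ avoided , avoidedX ]′ (x∈p∪q⁻ C X a∈C∪X)
        ; budget = begin
            2 * u′ + ∣ Y ∪ ⁅ z ⁆ ∣ * suc ∣ Y ∪ ⁅ z ⁆ ∣
              ≡⟨ cong (λ c → 2 * u′ + c * suc c) (x∉p⇒∣p∪⁅x⁆∣≡suc∣p∣ z∉Y) ⟩
            2 * u′ + suc ∣ Y ∣ * suc (suc ∣ Y ∣)        ≡⟨ grow u′ ∣ Y ∣ ⟨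
            2 * (u′ + suc ∣ Y ∣) + ∣ Y ∣ * suc ∣ Y ∣    ≡⟨ cong (λ c → 2 * c + ∣ Y ∣ * suc ∣ Y ∣) u′+1+∣Y∣≡u ⟩
            2 * ∣ A ─ C ∣ + ∣ Y ∣ * suc ∣ Y ∣            ≤⟨ budget ⟩
            2 * k + 2                                   ∎
        }
        where
        open ≤-Reasoning
        u′ : ℕ
        u′ = ∣ A ─ (C ∪ X) ∣
        u′+1+∣Y∣≡u : u′ + suc ∣ Y ∣ ≡ ∣ A ─ C ∣
        u′+1+∣Y∣≡u = trans (cong (u′ +_) (sym ∣X∣≡1+∣Y∣)) (∣p─[q∪r]∣+∣r∣≡∣p─q∣ X⊆A─C)
        grow : ∀ u q → 2 * (u + suc q) + q * suc q ≡ 2 * u + suc q * suc (suc q)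
        grow = solve-∀

      avoided-except : ∀ {W e} → A ∪ Y ⊆ W → uncovered s ≤ 1 → e ∈ A ─ C → AvoidedWithin W e →
                       ∀ {a} → a ∈ A → AvoidedWithin W a
      avoided-except A∪Y⊆W u≤1 e∈A─C avoidedₑ {a} a∈A with a ∈? C
      ... | yes a∈C = AvoidedWithin-mono A∪Y⊆W (avoided a∈C)
      ... | no a∉C = subst (AvoidedWithin _) (∣p∣≤1∧x∈p∧y∈p⇒x≡y u≤1 e∈A─C (x∈p∧x∉q⇒x∈p─q a∈A a∉C)) avoidedₑ

      one-more-avoided : ∀ {e} → e ∈ A ─ C → ∃[ z ] AvoidedWithin (A ∪ (Y ∪ ⁅ z ⁆)) e
      one-more-avoided {e} e∈A─C with x∈p─q⁻ e∈A─C
      ... | e∈A , e∉C with pair-trade e∈A (λ { refl → e∉C g∈C })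
      ... | inj₁ A-e∪y∈F = y , _ , A-e∪y∈F , ∪-monoˡ-⊆ (p─q⊆p A ⁅ e ⁆) ∘ ∪-monoʳ-⊆ (q⊆p∪q Y ⁅ y ⁆) , e∉A-e∪y
        where
        e∉A-e∪y : e ∉ (A - e) ∪ ⁅ y ⁆
        e∉A-e∪y e∈ with x∈p∪⁅y⁆⁻ e∈
        ... | inj₁ e∈A-e = proj₂ (x∈p-y⁻ e∈A-e) refl
        ... | inj₂ refl = y∉A e∈A
      ... | inj₂ (z , _ , _ , avoided-pair) =
            z , AvoidedWithin-mono (∪-monoʳ-⊆ (∪-monoˡ-⊆ (x∈p⇒⁅x⁆⊆p y∈Y)))
                                   (avoided-pair (x∈p∪q⁺ (inj₁ (x∈⁅x⁆ e))))

      finish : uncovered s ≤ 1 → ⊥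
      finish u≤1 with nonempty? (A ─ C)
      ... | no all-covered = ¬all-avoided-within y λ {a} a∈A →
            AvoidedWithin-mono A∪Y⊆A∪[Y∪⁅z⁆] (avoided (∣p─q∣≡0⇒p⊆q (Empty⇒∣p∣≡0 all-covered) a∈A))
      ... | yes (e , e∈A─C) = let z , avoidedₑ = one-more-avoided e∈A─C in
            ¬all-avoided-within z (avoided-except A∪Y⊆A∪[Y∪⁅z⁆] u≤1 e∈A─C avoidedₑ)

      ∣Y∣<k : 2 ≤ uncovered s → ∣ Y ∣ < k
      ∣Y∣<k 2≤u = m*[1+m]<n*[1+n]⇒m<n (begin-strict
        ∣ Y ∣ * suc ∣ Y ∣      <⟨ m<m+n _ (s≤s z≤n) ⟩
        ∣ Y ∣ * suc ∣ Y ∣ + 2  ≤⟨ +-cancelʳ-≤ 2 _ _ (begin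
          ∣ Y ∣ * suc ∣ Y ∣ + 2 + 2          ≡⟨ trans (+-assoc _ 2 2) (+-comm _ 4) ⟩
          4 + ∣ Y ∣ * suc ∣ Y ∣              ≤⟨ +-monoˡ-≤ _ (*-monoʳ-≤ 2 2≤u) ⟩
          2 * ∣ A ─ C ∣ + ∣ Y ∣ * suc ∣ Y ∣  ≤⟨ budget ⟩
          2 * k + 2                          ∎) ⟩
        2 * k                  ≤⟨ ≤-trans (≤-reflexive (*-comm 2 k)) (*-monoʳ-≤ k (s≤s (s≤s z≤n))) ⟩
        k * suc k              ∎)
        where open ≤-Reasoning

      pad : 2 ≤ uncovered s → uncovered s ≤ ∣ Y ∣ → ∃[ D ] A ─ C ⊆ D × D ⊆ A × ∣ D ∣ ≡ suc ∣ Y ∣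
      pad 2≤u u≤∣Y∣ =
        let E , E⊆A∩C , ∣E∣≡ = ∃⊆-ofSize (A ∩ C) room
            A─C#E : Disjoint (A ─ C) E
            A─C#E w∈A─C = proj₂ (x∈p─q⁻ w∈A─C) ∘ proj₂ ∘ x∈p∩q⁻ A C ∘ E⊆A∩C
        in (A ─ C) ∪ E , p⊆p∪q E , ∪-lub (p─q⊆p A C) (proj₁ ∘ x∈p∩q⁻ A C ∘ E⊆A∩C) , (begin-equality
             ∣ (A ─ C) ∪ E ∣                   ≡⟨ Disjoint⇒∣p∪q∣≡∣p∣+∣q∣ (A ─ C) E A─C#E ⟩
             ∣ A ─ C ∣ + ∣ E ∣                 ≡⟨ cong (∣ A ─ C ∣ +_) ∣E∣≡ ⟩
             ∣ A ─ C ∣ + (suc ∣ Y ∣ ∸ ∣ A ─ C ∣) ≡⟨ m+[n∸m]≡n (m≤n⇒m≤1+n u≤∣Y∣) ⟩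
             suc ∣ Y ∣                         ∎)
        where
        open ≤-Reasoning
        ∣A─C∣+∣A∩C∣≡∣A∣ : ∣ A ─ C ∣ + ∣ A ∩ C ∣ ≡ ∣ A ∣
        ∣A─C∣+∣A∩C∣≡∣A∣ = ∣p─q∣+∣p∩q∣≡∣p∣ A C
        room : suc ∣ Y ∣ ∸ ∣ A ─ C ∣ ≤ ∣ A ∩ C ∣
        room = begin
          suc ∣ Y ∣ ∸ ∣ A ─ C ∣              ≤⟨ ∸-monoˡ-≤ ∣ A ─ C ∣ (∣Y∣<k 2≤u) ⟩
          k ∸ ∣ A ─ C ∣                      ≡⟨ cong (_∸ ∣ A ─ C ∣) (trans (sym ∣A∣≡k) (sym ∣A─C∣+∣A∩C∣≡∣A∣)) ⟩
          ∣ A ─ C ∣ + ∣ A ∩ C ∣ ∸ ∣ A ─ C ∣  ≡⟨ m+n∸m≡n ∣ A ─ C ∣ ∣ A ∩ C ∣ ⟩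
          ∣ A ∩ C ∣                          ∎

      advance-many : suc ∣ Y ∣ ≤ uncovered s → Σ State λ s′ → uncovered s′ < uncovered s
      advance-many 1+∣Y∣≤u with ∃⊆-ofSize (A ─ C) 1+∣Y∣≤u
      ... | D , D⊆A─C , ∣D∣≡1+∣Y∣ with trade A∈F Y#A (p─q⊆p A C ∘ D⊆A─C) ∣D∣≡1+∣Y∣
      ... | z , _ , reenters z∈D avoided-D-z = absorb (D - z) avoided-D-z , (begin-strict
            ∣ A ─ (C ∪ (D - z)) ∣                  <⟨ m<m+n _ (x∈p⇒0<∣p∣ y∈Y) ⟩
            ∣ A ─ (C ∪ (D - z)) ∣ + ∣ Y ∣          ≡⟨ cong (∣ A ─ (C ∪ (D - z)) ∣ +_) ∣D-z∣≡∣Y∣ ⟨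
            ∣ A ─ (C ∪ (D - z)) ∣ + ∣ D - z ∣      ≡⟨ ∣p─[q∪r]∣+∣r∣≡∣p─q∣ (D⊆A─C ∘ proj₁ ∘ x∈p-y⁻) ⟩
            ∣ A ─ C ∣                              ∎)
        where
        open ≤-Reasoning
        ∣D-z∣≡∣Y∣ : ∣ D - z ∣ ≡ ∣ Y ∣
        ∣D-z∣≡∣Y∣ = suc-injective (trans (x∈p⇒suc∣p-x∣≡∣p∣ z∈D) ∣D∣≡1+∣Y∣)
      ... | z , _ , escapes z∉A z∉Y avoided-D =
            extend z D z∉A z∉Y D⊆A─C ∣D∣≡1+∣Y∣ avoided-D , (begin-strict
            ∣ A ─ (C ∪ D) ∣                <⟨ m<m+n _ (s≤s z≤n) ⟩
            ∣ A ─ (C ∪ D) ∣ + suc ∣ Y ∣    ≡⟨ cong (∣ A ─ (C ∪ D) ∣ +_) ∣D∣≡1+∣Y∣ ⟨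
            ∣ A ─ (C ∪ D) ∣ + ∣ D ∣        ≡⟨ ∣p─[q∪r]∣+∣r∣≡∣p─q∣ D⊆A─C ⟩
            ∣ A ─ C ∣                      ∎)
        where open ≤-Reasoning

      advance-last : 2 ≤ uncovered s → uncovered s ≤ ∣ Y ∣ → Σ State λ s′ → uncovered s′ ≤ 1
      advance-last 2≤u u≤∣Y∣ with pad 2≤u u≤∣Y∣
      ... | D , A─C⊆D , D⊆A , ∣D∣≡1+∣Y∣ with trade A∈F Y#A D⊆A ∣D∣≡1+∣Y∣
      ... | z , _ , reenters z∈D avoided-D-z =
            absorb (D - z) avoided-D-z , ≤-trans (p⊆q⇒∣p∣≤∣q∣ left⊆⁅z⁆) (≤-reflexive (∣⁅x⁆∣≡1 z))
        where
        left⊆⁅z⁆ : A ─ (C ∪ (D - z)) ⊆ ⁅ z ⁆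
        left⊆⁅z⁆ {w} w∈ with x∈p─q⁻ w∈ | w ≟ᶠ z
        ... | _ , _ | yes refl = x∈⁅x⁆ w
        ... | w∈A , w∉C∪[D-z] | no w≢z = contradiction (x∈p∪q⁺ (inj₂ (x∈p∧x≢y⇒x∈p-y
                (A─C⊆D (x∈p∧x∉q⇒x∈p─q w∈A (w∉C∪[D-z] ∘ x∈p∪q⁺ ∘ inj₁))) w≢z))) w∉C∪[D-z]
      ... | z , _ , escapes _ _ avoided-D = ⊥-elim (¬all-avoided-within z all-avoided)
        where
        all-avoided : ∀ {a} → a ∈ A → AvoidedWithin (A ∪ (Y ∪ ⁅ z ⁆)) a
        all-avoided {a} a∈A with a ∈? C
        ... | yes a∈C = AvoidedWithin-mono A∪Y⊆A∪[Y∪⁅z⁆] (avoided a∈C)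
        ... | no a∉C = avoided-D (A─C⊆D (x∈p∧x∉q⇒x∈p─q a∈A a∉C))

    impossible : State → ⊥
    impossible s = go s (<-wellFounded (uncovered s))
      where
      go : (s : State) → Acc _<_ (uncovered s) → ⊥
      go s (acc smaller) with 2 ≤? uncovered s
      ... | no u≱2 = finish s (≤-pred (≰⇒> u≱2))
      ... | yes 2≤u with suc ∣ State.Y s ∣ ≤? uncovered s
      ... | yes 1+∣Y∣≤u = let s′ , u′<u = advance-many s 1+∣Y∣≤u in go s′ (smaller u′<u)
      ... | no u≱1+∣Y∣ = let s′ , u′≤1 = advance-last s 2≤u (≤-pred (≰⇒> u≱1+∣Y∣)) in finish s′ u′≤1

    exchange : ∀ {d} → d ∈ A → d ≢ g → ((A - d) ∪ ⁅ y ⁆) ∈F F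
    exchange {d} d∈A d≢g with pair-trade d∈A d≢g
    ... | inj₁ A-d∪y∈F = A-d∪y∈F
    ... | inj₂ (z , z∉A , z≢y , avoided-pair) = ⊥-elim (impossible record
          { Y = ⁅ y ⁆ ∪ ⁅ z ⁆ ; C = ⁅ d ⁆ ∪ ⁅ g ⁆
          ; Y#A = Disjoint-∪ (x∉p⇒Disjoint⁅x⁆p y∉A) (x∉p⇒Disjoint⁅x⁆p z∉A)
          ; y∈Y = x∈p∪q⁺ (inj₁ (x∈⁅x⁆ y)) ; g∈C = y∈p∪⁅y⁆
          ; avoided = avoided-pair
          ; budget = ≤-reflexive (begin
              2 * ∣ A ─ D ∣ + ∣ ⁅ y ⁆ ∪ ⁅ z ⁆ ∣ * suc ∣ ⁅ y ⁆ ∪ ⁅ z ⁆ ∣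
                ≡⟨ cong (λ c → 2 * ∣ A ─ D ∣ + c * suc c) (x≢y⇒∣⁅x⁆∪⁅y⁆∣≡2 (z≢y ∘ sym)) ⟩
              2 * ∣ A ─ D ∣ + 2 * 3                                    ≡⟨ initial ∣ A ─ D ∣ ⟩
              2 * (∣ A ─ D ∣ + 2) + 2                                  ≡⟨ cong (λ c → 2 * c + 2) ∣A─D∣+2≡k ⟩
              2 * k + 2                                                ∎)
          })
      where
      open ≡-Reasoning
      D : Subset n
      D = ⁅ d ⁆ ∪ ⁅ g ⁆
      ∣A─D∣+2≡k : ∣ A ─ D ∣ + 2 ≡ k
      ∣A─D∣+2≡k = trans (cong (∣ A ─ D ∣ +_) (sym (x≢y⇒∣⁅x⁆∪⁅y⁆∣≡2 d≢g)))
                        (trans (∣p─q∣+∣q∣≡∣p∣ (pair⊆A d∈A)) ∣A∣≡k)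
      initial : ∀ u → 2 * u + 2 * 3 ≡ 2 * (u + 2) + 2
      initial = solve-∀

  MeetsOnlyAt : Subset n → Fin n → Subset n → Set
  MeetsOnlyAt G g A = A ∈F F × g ∈ A × (∀ {w} → w ∈ A → w ∈ G → w ≡ g)

  meetsOnlyAt⇒∪⁅g⁆∈F : ∀ {A G g} → G ∈F F → g ∈ G → MeetsOnlyAt G g A →
                        ∀ {S} → ∣ S ∣ ≡ K → Disjoint S G → (S ∪ ⁅ g ⁆) ∈F F
  meetsOnlyAt⇒∪⁅g⁆∈F {A} {G} {g} G∈F g∈G meets {S} ∣S∣≡K S#G =
    proj₁ (swap-walk (MeetsOnlyAt G g) (S ∪ ⁅ g ⁆) exchange-step ∣A∣≡∣S∪⁅g⁆∣ meets)
    where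
    ∣A∣≡∣S∪⁅g⁆∣ : ∣ A ∣ ≡ ∣ S ∪ ⁅ g ⁆ ∣
    ∣A∣≡∣S∪⁅g⁆∣ = trans (uniform A (proj₁ meets)) (trans (cong suc (sym ∣S∣≡K))
                  (sym (x∉p⇒∣p∪⁅x⁆∣≡suc∣p∣ (λ g∈S → S#G g∈S g∈G))))
    exchange-step : ∀ {B d y} → MeetsOnlyAt G g B → d ∈ B ─ (S ∪ ⁅ g ⁆) → y ∈ (S ∪ ⁅ g ⁆) ─ B →
                    MeetsOnlyAt G g ((B - d) ∪ ⁅ y ⁆)
    exchange-step {B} {d} {y} (B∈F , g∈B , B∩G⊆g) d∈B─S∪g y∈S∪g─B with x∈p─q⁻ d∈B─S∪g | x∈p─q⁻ y∈S∪g─B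
    ... | d∈B , d∉S∪g | y∈S∪g , y∉B with x∈p∪⁅y⁆⁻ y∈S∪g
    ... | inj₂ refl = contradiction g∈B y∉B
    ... | inj₁ y∈S =
          Exchange.exchange B∈F G∈F g∈B B∩G⊆g y∉B (S#G y∈S) d∈B (λ { refl → d∉S∪g y∈p∪⁅y⁆ }) ,
          x∈p∪q⁺ (inj₁ (x∈p∧x≢y⇒x∈p-y g∈B λ { refl → d∉S∪g y∈p∪⁅y⁆ })) ,
          λ w∈ w∈G → [ (λ w∈B-d → B∩G⊆g (proj₁ (x∈p-y⁻ w∈B-d)) w∈G)
                     , (λ { refl → contradiction w∈G (S#G y∈S) }) ]′ (x∈p∪⁅y⁆⁻ w∈)

  ∣A-x∣≡K : ∀ {A : Subset n} {x} → ∣ A ∣ ≡ k → x ∈ A → ∣ A - x ∣ ≡ K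
  ∣A-x∣≡K ∣A∣≡k x∈A = suc-injective (trans (x∈p⇒suc∣p-x∣≡∣p∣ x∈A) ∣A∣≡k)

  module Centre (x : Fin n) where

    Petal : Subset n → Set
    Petal S = x ∉ S × ∣ S ∣ ≡ K × (S ∪ ⁅ x ⁆) ∈F F

    disjoint-petals⇒petal : ∀ {P Q} → Petal P → Petal Q → Disjoint P Q →
                            ∀ {S} → x ∉ S → ∣ S ∣ ≡ K → Disjoint S Q → Petal S
    disjoint-petals⇒petal {P} {Q} (x∉P , _ , P∪x∈F) (x∉Q , _ , Q∪x∈F) P#Q {S} x∉S ∣S∣≡K S#Q =
      x∉S , ∣S∣≡K , meetsOnlyAt⇒∪⁅g⁆∈F Q∪x∈F y∈p∪⁅y⁆ (P∪x∈F , y∈p∪⁅y⁆ , only-x) ∣S∣≡K S#Q∪x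
      where
      only-x : ∀ {w} → w ∈ P ∪ ⁅ x ⁆ → w ∈ Q ∪ ⁅ x ⁆ → w ≡ x
      only-x w∈P∪x w∈Q∪x with x∈p∪⁅y⁆⁻ w∈P∪x | x∈p∪⁅y⁆⁻ w∈Q∪x
      ... | inj₂ w≡x | _ = w≡x
      ... | inj₁ _ | inj₂ w≡x = w≡x
      ... | inj₁ w∈P | inj₁ w∈Q = contradiction w∈Q (P#Q w∈P)
      S#Q∪x : Disjoint S (Q ∪ ⁅ x ⁆)
      S#Q∪x w∈S w∈Q∪x with x∈p∪⁅y⁆⁻ w∈Q∪x
      ... | inj₁ w∈Q = S#Q w∈S w∈Q
      ... | inj₂ refl = x∉S w∈S

    PairedPetal : Subset n → Set
    PairedPetal S = Petal S × ∃[ P ] Petal P × Disjoint S P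

    -- The new partner W avoids S, b and x; it is a petal by the old pair, and it pairs with the swapped set.
    swap : ∀ {S a b} → a ∈ S → b ∉ S → b ≢ x → PairedPetal S → PairedPetal ((S - a) ∪ ⁅ b ⁆)
    swap {S} {a} {b} a∈S b∉S b≢x (petal-S@(x∉S , ∣S∣≡K , _) , P , petal-P , S#P) =
      disjoint-petals⇒petal petal-S petal-W S#W x∉S′ (trans (x∈p∧y∉p⇒∣[p-x]∪⁅y⁆∣≡∣p∣ a∈S b∉S) ∣S∣≡K) S′#W ,
      W , petal-W , S′#W
      where
      x∉S′ : x ∉ (S - a) ∪ ⁅ b ⁆
      x∉S′ x∈S′ = [ x∉S ∘ proj₁ ∘ x∈p-y⁻ , b≢x ∘ sym ]′ (x∈p∪⁅y⁆⁻ x∈S′)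
      Z : Subset n
      Z = (S ∪ ⁅ b ⁆) ∪ ⁅ x ⁆
      fresh-W : ∃[ W ] ∣ W ∣ ≡ K × Disjoint W Z
      fresh-W = fresh Z (begin
        ∣ (S ∪ ⁅ b ⁆) ∪ ⁅ x ⁆ ∣  ≤⟨ ∣p∪⁅x⁆∣≤suc∣p∣ (S ∪ ⁅ b ⁆) x ⟩
        suc ∣ S ∪ ⁅ b ⁆ ∣        ≤⟨ s≤s (∣p∪⁅x⁆∣≤suc∣p∣ S b) ⟩
        suc (suc ∣ S ∣)          ≡⟨ cong (λ c → suc (suc c)) ∣S∣≡K ⟩
        suc k                    ≤⟨ 1+k≤k+t+1 ⟩
        k + t + 1                ∎)
        where open ≤-Reasoning
      W : Subset n
      W = proj₁ fresh-W
      W#Z : Disjoint W Z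
      W#Z = proj₂ (proj₂ fresh-W)
      S#W : Disjoint S W
      S#W w∈S w∈W = W#Z w∈W (x∈p∪q⁺ (inj₁ (x∈p∪q⁺ (inj₁ w∈S))))
      petal-W : Petal W
      petal-W = disjoint-petals⇒petal petal-P petal-S (λ w∈P w∈S → S#P w∈S w∈P)
                  (λ x∈W → W#Z x∈W y∈p∪⁅y⁆) (proj₁ (proj₂ fresh-W)) (λ w∈W w∈S → S#W w∈S w∈W)
      S′#W : Disjoint ((S - a) ∪ ⁅ b ⁆) W
      S′#W w∈S′ w∈W with x∈p∪⁅y⁆⁻ w∈S′
      ... | inj₁ w∈S-a = S#W (proj₁ (x∈p-y⁻ w∈S-a)) w∈W
      ... | inj₂ refl = W#Z w∈W (x∈p∪q⁺ (inj₁ y∈p∪⁅y⁆))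

    paired⇒petal : ∀ {S₀} → PairedPetal S₀ → ∀ {S} → x ∉ S → ∣ S ∣ ≡ K → (S ∪ ⁅ x ⁆) ∈F F
    paired⇒petal paired@((_ , ∣S₀∣≡K , _) , _) {S} x∉S ∣S∣≡K =
      proj₂ (proj₂ (proj₁ (swap-walk PairedPetal S step (trans ∣S₀∣≡K (sym ∣S∣≡K)) paired)))
      where
      step : ∀ {p a b} → PairedPetal p → a ∈ p ─ S → b ∈ S ─ p → PairedPetal ((p - a) ∪ ⁅ b ⁆)
      step paired-p a∈p─S b∈S─p =
        let b∈S , b∉p = x∈p─q⁻ b∈S─p
        in swap (proj₁ (x∈p─q⁻ a∈p─S)) b∉p (λ { refl → x∉S b∈S }) paired-p

    member-pairs : ∀ {T G} → Petal T → G ∈F F → x ∈ G → Disjoint T G → PairedPetal T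
    member-pairs {T} {G} petal-T G∈F x∈G T#G =
      petal-T , G - x , ((λ x∈G-x → proj₂ (x∈p-y⁻ x∈G-x) refl) , ∣A-x∣≡K {G} (uniform G G∈F) x∈G ,
                     subst (_∈F F) (sym (p-x∪⁅x⁆≡p x∈G)) G∈F) ,
      λ w∈T w∈G-x → T#G w∈T (proj₁ (x∈p-y⁻ w∈G-x))

    all-petals⇒star : (∀ {S} → x ∉ S → ∣ S ∣ ≡ K → (S ∪ ⁅ x ⁆) ∈F F) → ∀ A → A ∈F F ⇔ (∣ A ∣ ≡ k × x ∈ A)
    all-petals⇒star petal A = mk⇔ (λ A∈F → uniform A A∈F , every-member∋x A∈F) λ (∣A∣≡k , x∈A) →
      subst (_∈F F) (p-x∪⁅x⁆≡p x∈A) (petal (λ x∈A-x → proj₂ (x∈p-y⁻ x∈A-x) refl) (∣A-x∣≡K {A} ∣A∣≡k x∈A))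
      where
      every-member∋x : ∀ {H} → H ∈F F → x ∈ H
      every-member∋x {H} H∈F =
        let S , ∣S∣≡K , S#H∪x = fresh (H ∪ ⁅ x ⁆)
              (≤-trans (∣p∪⁅x⁆∣≤suc∣p∣ H x) (≤-trans (s≤s (≤-reflexive (uniform H H∈F))) 1+k≤k+t+1))
        in added-point-∈ (petal (λ x∈S → S#H∪x x∈S y∈p∪⁅y⁆) ∣S∣≡K) H∈F (λ w∈S → S#H∪x w∈S ∘ x∈p∪q⁺ ∘ inj₁)

  full-shadow⇒complete-star : IsCompleteStar k F
  full-shadow⇒complete-star =
    let S₀ , ∣S₀∣≡K , _ = fresh ∅ (subst (_≤ k + t + 1) (sym (∣⊥∣≡0 n)) z≤n)
        z₀ , _ , G∈F = full S₀ ∣S₀∣≡K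
        T , ∣T∣≡K , T#G = fresh (S₀ ∪ ⁅ z₀ ⁆)
                            (≤-trans (≤-reflexive (uniform _ G∈F)) (≤-trans (n≤1+n k) 1+k≤k+t+1))
        x , x∉T , T∪x∈F = full T ∣T∣≡K
        open Centre x
        x∈G = added-point-∈ T∪x∈F G∈F T#G
    in x , all-petals⇒star (paired⇒petal (member-pairs (x∉T , ∣T∣≡K , T∪x∈F) G∈F x∈G T#G))

-- Complete stars

module _ {n K : ℕ} {F : Family n} (K<n : K < n) (star : IsCompleteStar (suc K) F) where

  private
    c : Fin n
    c = proj₁ star
    ∈F⇔ : ∀ {A} → A ∈F F ⇔ (∣ A ∣ ≡ suc K × c ∈ A)
    ∈F⇔ {A} = proj₂ star A

  completeStar⇒minDegree≤1 : minDegree K F ≤ 1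
  completeStar⇒minDegree≤1 =
    let S , ∣S∣≡K , S#⁅c⁆ = ∃-disjoint-ofSize ⁅ c ⁆
                              (≤-trans (≤-reflexive (trans (cong (K +_) (∣⁅x⁆∣≡1 c)) (+-comm K 1))) K<n)
    in ≤-trans (minDegree≤degree F ∣S∣≡K) (unique-superset⇒degree≤1 F S λ T∈F S⊆T →
         let ∣T∣≡k , c∈T = Equivalence.to ∈F⇔ T∈F
             c∉S = λ c∈S → S#⁅c⁆ c∈S (x∈⁅x⁆ c)
         in sym (p⊆q⇒∣q∣≤∣p∣⇒p≡q (∪-lub S⊆T (x∈p⇒⁅x⁆⊆p c∈T))
                  (≤-reflexive (trans ∣T∣≡k (sym (trans (x∉p⇒∣p∪⁅x⁆∣≡suc∣p∣ c∉S) (cong suc ∣S∣≡K)))))))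

  completeStar⇒1≤minDegree : 1 ≤ minDegree K F
  completeStar⇒1≤minDegree =
    ≤minDegree F (∃-ofSize (<⇒≤ K<n))
      λ {S} ∣S∣≡K → let z , z∉S , c∈S∪z = completing-point ∣S∣≡K in
        superset⇒0<degree F S (Equivalence.from ∈F⇔ (trans (x∉p⇒∣p∪⁅x⁆∣≡suc∣p∣ z∉S) (cong suc ∣S∣≡K) , c∈S∪z))
                              (λ {w} → p⊆p∪q ⁅ z ⁆)
    where
    completing-point : ∀ {S} → ∣ S ∣ ≡ K → ∃[ z ] z ∉ S × c ∈ S ∪ ⁅ z ⁆
    completing-point {S} ∣S∣≡K with c ∈? S
    ... | no c∉S = c , c∉S , x∈p∪q⁺ (inj₂ (x∈⁅x⁆ c))
    ... | yes c∈S =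
          let z , z∈∁S = 0<∣p∣⇒Nonempty
                           (subst (0 <_) (sym (trans (∣∁p∣≡n∸∣p∣ S) (cong (n ∸_) ∣S∣≡K))) (m<n⇒0<n∸m K<n))
          in z , x∈∁p⇒x∉p z∈∁S , x∈p∪q⁺ (inj₁ c∈S)

theorem1p2 : (k n t : ℕ) → 2 ≤ k → (F : Family n) → IsUniform k F → IsIntersecting F
           → IsCeilTerm k t → 2 * k + t + 3 ≤ n
           → (minDegree (k ∸ 1) F ≤ 1) × ((minDegree (k ∸ 1) F ≡ 1) ⇔ IsCompleteStar k F)
theorem1p2 zero _ _ () _ _ _ _ _
theorem1p2 (suc K) n t _ F uniform intersecting (t-ceil , _) n-large =
  minDegree≤1 , mk⇔ (positive⇒star ∘ ≤-reflexive ∘ sym)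
                    λ star → ≤-antisym (completeStar⇒minDegree≤1 K<n star) (completeStar⇒1≤minDegree K<n star)
  where
  K<n : K < n
  K<n = ≤-trans (m≤m+n (suc K) _) (≤-trans (m≤m+n (2 * suc K) t) (≤-trans (m≤m+n _ 3) n-large))
  positive⇒star : 1 ≤ minDegree K F → IsCompleteStar (suc K) F
  positive⇒star 1≤δ = WithFullShadow.full-shadow⇒complete-star uniform intersecting
                        (1≤minDegree⇒FullShadow uniform 1≤δ) t-ceil n-large
  minDegree≤1 : minDegree K F ≤ 1
  minDegree≤1 with 1 ≤? minDegree K F
  ... | yes 1≤δ = completeStar⇒minDegree≤1 K<n (positive⇒star 1≤δ)
  ... | no 1≰δ = ≤-trans (≤-pred (≰⇒> 1≰δ)) z≤n
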